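{- Let $V$ be a finite set, $\mathcal{F}\subseteq 2^V$ with $\emptyset,V\in\mathcal{F}$, and $f,g:\mathcal{F}\to\mathbb{R}$ non-decreasing with respect to inclusion with $f(\emptyset)=g(\emptyset)=0$. If $\mathcal{S}$ is an $\mathcal{F}$-chain, then $C_{f,g}(\mathcal{S})=C_{g^\#,f^\#}(\mathcal{S}^\#)$, and for $\alpha\ge1$, $\mathcal{S}$ is an $\alpha$-approximation for MSOP with inputs $(f,g,\mathcal{F})$ if and only if $\mathcal{S}^\#$ is an $\alpha$-approximation for MSOP with inputs $(g^\#,f^\#,\mathcal{F}^\#)$.
   Context: For $\mathcal{G}\subseteq 2^V$ containing $\emptyset,V$ and $F,G:\mathcal{G}\to\mathbb{R}$, a $\mathcal{G}$-chain is $(S_j)_{j=0}^k$, $k\in\{1,\dots,|V|\}$, with $\emptyset=S_0\subsetneq\cdots\subsetneq S_k=V$ and $S_j\in\mathcal{G}$; $C_{F,G}(\mathcal{S})=\sum_{j=1}^k F(S_j)(G(S_j)-G(S_{j-1}))$; MSOP with inputs $(F,G,\mathcal{G})$ is to minimize $C_{F,G}$ over $\mathcal{G}$-chains, and an $\alpha$-approximation is a chain with cost at most $\alpha$ times the minimum. $\mathcal{F}^\#=\{S\subseteq V: V\setminus S\in\mathcal{F}\}$. For an $\mathcal{F}$-chain $\mathcal{S}=(S_j)_{j=0}^k$, its dual chain is $\mathcal{S}^\#=(V\setminus S_{k-j})_{j=0}^k$, an $\mathcal{F}^\#$-chain. The dual functions $f^\#,g^\#:\mathcal{F}^\#\to\mathbb{R}$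 are $f^\#(S)=f(V)-f(V\setminus S)$ and $g^\#(S)=g(V)-g(V\setminus S)$. -}

module Defs where

open import Level using (Level; suc; _⊔_; 0ℓ)
open import Algebra.Bundles using (CommutativeRing)
open import Relation.Binary.Core using (Rel)
open import Relation.Binary.Structures using (IsTotalOrder)
open import Data.Nat as ℕ using (ℕ; zero; _∸_; s≤s; z≤n)
import Data.Nat.Properties as ℕP
open import Data.Bool using (not)
open import Data.Bool.Properties using (not-involutive)
open import Data.Vec using ([]; _∷_)
open import Data.Fin.Subset using (Subset; ⊥; ⊤; ∁; _⊆_; _⊂_)
open import Data.Fin.Subset.Properties using (p⊂q⇒∁p⊃∁q)
open import Data.Product using (_×_)
open import Function.Bundles using (_⇔_)
open import Relation.Binary.PropositionalEquality
  using (_≡_; refl; cong; cong₂; subst; sym; trans)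

-- The paper works
-- over ℝ, which the standard library does not provide; we work over an
-- arbitrary totally ordered commutative ring, of which ℝ is an instance.

record OrderedCommRing (c ℓ₁ ℓ₂ : Level) : Set (suc (c ⊔ ℓ₁ ⊔ ℓ₂)) where
  field
    commutativeRing : CommutativeRing c ℓ₁
  open CommutativeRing commutativeRing public
  infix 4 _≤_
  field
    _≤_           : Rel Carrier ℓ₂
    isTotalOrder  : IsTotalOrder _≈_ _≤_
    +-mono-≤      : ∀ {x y} z → x ≤ y → x + z ≤ y + z
    *-nonneg      : ∀ {x y} → 0# ≤ x → 0# ≤ y → 0# ≤ x * y

private
  ∁∁ : ∀ {n} (p : Subset n) → ∁ (∁ p) ≡ p
  ∁∁ []      = refl
  ∁∁ (b ∷ p) = cong₂ _∷_ (not-involutive b) (∁∁ p)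

  ∁⊤ : ∀ {n} → ∁ (⊤ {n}) ≡ ⊥
  ∁⊤ {zero}    = refl
  ∁⊤ {ℕ.suc n} = cong (_ ∷_) (∁⊤ {n})

  ∁⊥ : ∀ {n} → ∁ (⊥ {n}) ≡ ⊤
  ∁⊥ {zero}    = refl
  ∁⊥ {ℕ.suc n} = cong (_ ∷_) (∁⊥ {n})

  ∸-suc : ∀ {j k} → j ℕ.< k → k ∸ j ≡ ℕ.suc (k ∸ ℕ.suc j)
  ∸-suc {zero}    {ℕ.suc k} _         = refl
  ∸-suc {ℕ.suc j} {ℕ.suc k} (s≤s j<k) = ∸-suc {j} {k} j<k

_# : ∀ {n} → (Subset n → Set) → (Subset n → Set)
(𝓕 #) S = 𝓕 (∁ S)

-- 𝓕-chains  ∅ = S₀ ⊊ S₁ ⊊ ⋯ ⊊ S_k = V,  k ∈ {1,…,|V|}, all S_j ∈ 𝓕.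
-- The chain is given by S : ℕ → Subset n; only the values S 0 … S k
-- are meaningful.

record Chain {n : ℕ} (𝓕 : Subset n → Set) : Set where
  field
    k      : ℕ
    1≤k    : 1 ℕ.≤ k
    k≤n    : k ℕ.≤ n
    S      : ℕ → Subset n
    S₀≡∅   : S 0 ≡ ⊥
    Sₖ≡V   : S k ≡ ⊤
    S∈𝓕    : ∀ j → j ℕ.≤ k → 𝓕 (S j)
    strict : ∀ j → j ℕ.< k → S j ⊂ S (ℕ.suc j)

open Chain public

dual : ∀ {n} {𝓕 : Subset n → Set} → Chain 𝓕 → Chain (𝓕 #)
dual {n} {𝓕} ch = record
  { k      = k ch
  ; 1≤k    = 1≤k ch
  ; k≤n    = k≤n ch
  ; S      = λ j → ∁ (S ch (k ch ∸ j))
  ; S₀≡∅   = trans (cong ∁ (Sₖ≡V ch)) ∁⊤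
  ; Sₖ≡V   = trans (cong (λ i → ∁ (S ch i)) (ℕP.n∸n≡0 (k ch)))
                   (trans (cong ∁ (S₀≡∅ ch)) ∁⊥)
  ; S∈𝓕    = λ j _ → subst 𝓕 (sym (∁∁ (S ch (k ch ∸ j))))
                        (S∈𝓕 ch (k ch ∸ j) (ℕP.m∸n≤m (k ch) j))
  ; strict = λ j j<k → subst (λ i → ∁ (S ch i) ⊂ ∁ (S ch (k ch ∸ ℕ.suc j)))
                          (sym (∸-suc j<k))
                          (p⊂q⇒∁p⊃∁q (strict ch (k ch ∸ ℕ.suc j)
                             (ℕP.∸-monoʳ-< {o = 0} (s≤s z≤n) j<k)))
  }

module _ {c ℓ₁ ℓ₂} (R : OrderedCommRing c ℓ₁ ℓ₂) where
  open OrderedCommRing R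

  partialCost : ∀ {n} → (Subset n → Carrier) → (Subset n → Carrier)
              → (ℕ → Subset n) → ℕ → Carrier
  partialCost F G S zero      = 0#
  partialCost F G S (ℕ.suc j) =
    partialCost F G S j + F (S (ℕ.suc j)) * (G (S (ℕ.suc j)) - G (S j))

  cost : ∀ {n} {𝓖 : Subset n → Set} → (Subset n → Carrier) → (Subset n → Carrier)
       → Chain 𝓖 → Carrier
  cost F G ch = partialCost F G (S ch) (k ch)

  dualFun : ∀ {n} → (Subset n → Carrier) → (Subset n → Carrier)
  dualFun f X = f ⊤ - f (∁ X)

  Monotone : ∀ {n} → (Subset n → Set) → (Subset n → Carrier) → Set (ℓ₂)
  Monotone 𝓕 f = ∀ X Y → 𝓕 X → 𝓕 Y → X ⊆ Y → f X ≤ f Y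

  -- 𝓢 is an α-approximation for MSOP with inputs (F,G,𝓖):
  -- its cost is at most α times the cost of every 𝓖-chain
  -- (equivalently, at most α times the minimum, the set of chains being finite).
  IsApprox : ∀ {n} → (Subset n → Carrier) → (Subset n → Carrier)
           → (𝓖 : Subset n → Set) → Carrier → Chain 𝓖 → Set (ℓ₂)
  IsApprox F G 𝓖 α ch = ∀ (T : Chain 𝓖) → cost F G ch ≤ α * cost F G T

-- Write a = f ∘ S and b = g ∘ S along the chain and B = g(V).  The term of
-- the dual cost with index j is (B − b_i)(a_{i+1} − a_i) for i = k − j, so
-- reversing the order of summation turns the dual cost into
-- Σ_i (B − b_i)(a_{i+1} − a_i).  Abel summation identifies this with
-- C_{f,g}(𝓢) = Σ_i a_{i+1}(b_{i+1} − b_i), the boundary terms a_i(B − b_i)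
-- vanishing at i = 0 (a_0 = f(∅) = 0) and at i = k (b_k = g(V) = B).
-- Dualising is a cost-preserving bijection between 𝓕-chains and
-- 𝓕^#-chains, so it also preserves α-approximations.
module Submission where

open import Defs
open import Level using (Level)
open import Data.Nat using (ℕ)
open import Data.Fin.Subset using (Subset; ⊥; ⊤)
open import Data.Product using (_×_)
open import Function.Bundles using (_⇔_)

open import Algebra.Bundles using (CommutativeMonoid; CommutativeRing)
open import Data.Bool.Properties using (not-involutive)
open import Data.Fin.Subset using (∁; _⊂_)
open import Data.Fin.Subset.Properties using (p⊂q⇒∁p⊃∁q)
open import Data.Nat as ℕ using (zero; suc; _∸_; s≤s; z≤n)
open import Data.Nat.Properties
  using (n∸n≡0; m∸n≤m; ∸-monoʳ-<; +-∸-assoc; m∸[m∸n]≡n; <⇒≤; m<n⇒m<1+n; n<1+n)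
open import Data.Product using (_,_)
open import Data.Vec using ([]; _∷_)
open import Function.Base using (_∘_)
open import Function.Bundles using (mk⇔)
open import Relation.Binary.PropositionalEquality using (_≡_)
import Relation.Binary.PropositionalEquality as ≡
import Relation.Binary.Reasoning.Base.Double as PreorderReasoning
import Relation.Binary.Reasoning.Setoid as SetoidReasoning
open import Relation.Binary.Structures using (IsTotalOrder)

∁-involutive : ∀ {n} (p : Subset n) → ∁ (∁ p) ≡ p
∁-involutive []      = ≡.refl
∁-involutive (b ∷ p) = ≡.cong₂ _∷_ (not-involutive b) (∁-involutive p)

∁⊤≡⊥ : ∀ {n} → ∁ (⊤ {n}) ≡ ⊥
∁⊤≡⊥ {zero}  = ≡.refl
∁⊤≡⊥ {suc n} = ≡.cong (_ ∷_) (∁⊤≡⊥ {n})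

∁⊥≡⊤ : ∀ {n} → ∁ (⊥ {n}) ≡ ⊤
∁⊥≡⊤ {zero}  = ≡.refl
∁⊥≡⊤ {suc n} = ≡.cong (_ ∷_) (∁⊥≡⊤ {n})

-- The inverse of dual; dual itself cannot be reused because the family
-- (𝓕 #) # is 𝓕 ∘ ∁ ∘ ∁ rather than 𝓕.
undual : ∀ {n} {𝓕 : Subset n → Set} → Chain (𝓕 #) → Chain 𝓕
undual 𝓣 = record
  { k      = k 𝓣
  ; 1≤k    = 1≤k 𝓣
  ; k≤n    = k≤n 𝓣
  ; S      = λ j → ∁ (S 𝓣 (k 𝓣 ∸ j))
  ; S₀≡∅   = ≡.trans (≡.cong ∁ (Sₖ≡V 𝓣)) ∁⊤≡⊥
  ; Sₖ≡V   = ≡.trans (≡.cong (∁ ∘ S 𝓣) (n∸n≡0 (k 𝓣))) (≡.trans (≡.cong ∁ (S₀≡∅ 𝓣)) ∁⊥≡⊤)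
  ; S∈𝓕    = λ j _ → S∈𝓕 𝓣 (k 𝓣 ∸ j) (m∸n≤m (k 𝓣) j)
  ; strict = λ j j<k →
      ≡.subst (λ i → ∁ (S 𝓣 i) ⊂ ∁ (S 𝓣 (k 𝓣 ∸ suc j))) (≡.sym (+-∸-assoc 1 j<k))
        (p⊂q⇒∁p⊃∁q (strict 𝓣 (k 𝓣 ∸ suc j) (∸-monoʳ-< (s≤s z≤n) j<k)))
  }

module FiniteSums {c ℓ} (M : CommutativeMonoid c ℓ) where
  open CommutativeMonoid M
  open SetoidReasoning setoid

  Σ< : ℕ → (ℕ → Carrier) → Carrier
  Σ< zero    u = ε
  Σ< (suc m) u = Σ< m u ∙ u m

  Σ<-cong : ∀ m {u v : ℕ → Carrier} → (∀ i → i ℕ.< m → u i ≈ v i) → Σ< m u ≈ Σ< m v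
  Σ<-cong zero    u≈v = refl
  Σ<-cong (suc m) u≈v =
    ∙-cong (Σ<-cong m (λ i i<m → u≈v i (m<n⇒m<1+n i<m))) (u≈v m (n<1+n m))

  Σ<-suc : ∀ m (u : ℕ → Carrier) → Σ< (suc m) u ≈ u 0 ∙ Σ< m (u ∘ suc)
  Σ<-suc zero    u = trans (identityˡ (u 0)) (sym (identityʳ (u 0)))
  Σ<-suc (suc m) u = begin
    Σ< (suc m) u ∙ u (suc m)             ≈⟨ ∙-congʳ (Σ<-suc m u) ⟩
    (u 0 ∙ Σ< m (u ∘ suc)) ∙ u (suc m)   ≈⟨ assoc _ _ _ ⟩
    u 0 ∙ Σ< (suc m) (u ∘ suc)           ∎

  Σ<-reverse : ∀ m (u : ℕ → Carrier) → Σ< m (λ i → u (m ∸ suc i)) ≈ Σ< m u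
  Σ<-reverse zero    u = refl
  Σ<-reverse (suc m) u = begin
    Σ< (suc m) (λ i → u (m ∸ i))     ≈⟨ Σ<-suc m (λ i → u (m ∸ i)) ⟩
    u m ∙ Σ< m (λ i → u (m ∸ suc i)) ≈⟨ ∙-congˡ (Σ<-reverse m u) ⟩
    u m ∙ Σ< m u                     ≈⟨ comm _ _ ⟩
    Σ< (suc m) u                     ∎

module SummationByParts {c ℓ} (CR : CommutativeRing c ℓ) where
  open CommutativeRing CR
  open import Algebra.Properties.Ring ring
    using (⁻¹-anti-homo‿-; [y-z]x≈yx-zx)
  open FiniteSums +-commutativeMonoid public
  open SetoidReasoning setoid

  [x-y]+y≈x : ∀ x y → (x - y) + y ≈ x
  [x-y]+y≈x x y = begin
    (x - y) + y   ≈⟨ +-assoc x (- y) y ⟩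
    x + (- y + y) ≈⟨ +-congˡ (-‿inverseˡ y) ⟩
    x + 0#        ≈⟨ +-identityʳ x ⟩
    x             ∎

  [y-z]+[x-y]≈x-z : ∀ x y z → (y - z) + (x - y) ≈ x - z
  [y-z]+[x-y]≈x-z x y z = begin
    (y - z) + (x - y)   ≈⟨ +-comm (y - z) (x - y) ⟩
    (x - y) + (y - z)   ≈⟨ +-assoc x (- y) (y - z) ⟩
    x + (- y + (y - z)) ≈⟨ +-congˡ (sym (+-assoc (- y) y (- z))) ⟩
    x + ((- y + y) - z) ≈⟨ +-congˡ (+-congʳ (-‿inverseˡ y)) ⟩
    x + (0# - z)        ≈⟨ +-congˡ (+-identityˡ (- z)) ⟩
    x - z               ∎

  [x-z]-[x-y]≈y-z : ∀ x y z → (x - z) - (x - y) ≈ y - z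
  [x-z]-[x-y]≈y-z x y z = begin
    (x - z) - (x - y) ≈⟨ +-congˡ (⁻¹-anti-homo‿- x y) ⟩
    (x - z) + (y - x) ≈⟨ [y-z]+[x-y]≈x-z y x z ⟩
    y - z             ∎

  xc≈yc+c[x-y] : ∀ x y c → x * c ≈ y * c + c * (x - y)
  xc≈yc+c[x-y] x y c = sym (begin
    y * c + c * (x - y)     ≈⟨ +-congˡ (*-comm c (x - y)) ⟩
    y * c + (x - y) * c     ≈⟨ +-congˡ ([y-z]x≈yx-zx c x y) ⟩
    y * c + (x * c - y * c) ≈⟨ +-comm (y * c) _ ⟩
    (x * c - y * c) + y * c ≈⟨ [x-y]+y≈x (x * c) (y * c) ⟩
    x * c                   ∎)

  y≈z⇒x[z-y]≈0 : ∀ x {y z} → y ≈ z → x * (z - y) ≈ 0#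
  y≈z⇒x[z-y]≈0 x {y} {z} y≈z = begin
    x * (z - y) ≈⟨ *-congˡ (+-congʳ (sym y≈z)) ⟩
    x * (y - y) ≈⟨ *-congˡ (-‿inverseʳ y) ⟩
    x * 0#      ≈⟨ zeroʳ x ⟩
    0#          ∎

  summation-by-parts : ∀ (a b : ℕ → Carrier) B m →
    Σ< m (λ i → a (suc i) * (b (suc i) - b i)) + a m * (B - b m)
      ≈ Σ< m (λ i → (B - b i) * (a (suc i) - a i)) + a 0 * (B - b 0)
  summation-by-parts a b B zero    = refl
  summation-by-parts a b B (suc m) = begin
    (L + a′ * (b′ - b m)) + a′ * (B - b′)   ≈⟨ +-assoc L _ _ ⟩
    L + (a′ * (b′ - b m) + a′ * (B - b′))   ≈⟨ +-congˡ (sym (distribˡ a′ _ _)) ⟩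
    L + a′ * ((b′ - b m) + (B - b′))        ≈⟨ +-congˡ (*-congˡ ([y-z]+[x-y]≈x-z B b′ (b m))) ⟩
    L + a′ * (B - b m)                      ≈⟨ +-congˡ (xc≈yc+c[x-y] a′ (a m) (B - b m)) ⟩
    L + (a m * (B - b m) + Δ)               ≈⟨ sym (+-assoc L _ Δ) ⟩
    (L + a m * (B - b m)) + Δ               ≈⟨ +-congʳ (summation-by-parts a b B m) ⟩
    (R + a 0 * (B - b 0)) + Δ               ≈⟨ +-assoc R _ Δ ⟩
    R + (a 0 * (B - b 0) + Δ)               ≈⟨ +-congˡ (+-comm _ Δ) ⟩
    R + (Δ + a 0 * (B - b 0))               ≈⟨ sym (+-assoc R Δ _) ⟩
    (R + Δ) + a 0 * (B - b 0)               ∎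
    where
    a′ = a (suc m)
    b′ = b (suc m)
    L  = Σ< m (λ i → a (suc i) * (b (suc i) - b i))
    R  = Σ< m (λ i → (B - b i) * (a (suc i) - a i))
    Δ  = (B - b m) * (a′ - a m)

  summation-by-parts-without-boundary : ∀ (a b : ℕ → Carrier) B m →
    a 0 ≈ 0# → b m ≈ B →
    Σ< m (λ i → a (suc i) * (b (suc i) - b i))
      ≈ Σ< m (λ i → (B - b i) * (a (suc i) - a i))
  summation-by-parts-without-boundary a b B m a₀≈0 bₘ≈B = begin
    L                                ≈⟨ sym (+-identityʳ L) ⟩
    L + 0#                           ≈⟨ +-congˡ (sym (y≈z⇒x[z-y]≈0 (a m) bₘ≈B)) ⟩
    L + a m * (B - b m)              ≈⟨ summation-by-parts a b B m ⟩
    R + a 0 * (B - b 0)              ≈⟨ +-congˡ (*-congʳ a₀≈0) ⟩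
    R + 0# * (B - b 0)               ≈⟨ +-congˡ (zeroˡ _) ⟩
    R + 0#                           ≈⟨ +-identityʳ R ⟩
    R                                ∎
    where
    L = Σ< m (λ i → a (suc i) * (b (suc i) - b i))
    R = Σ< m (λ i → (B - b i) * (a (suc i) - a i))

module Duality {c ℓ₁ ℓ₂} (R : OrderedCommRing c ℓ₁ ℓ₂) where
  open OrderedCommRing R
  open SummationByParts commutativeRing
  open SetoidReasoning setoid

  partialCost≡Σ< : ∀ {n} (F G : Subset n → Carrier) (S : ℕ → Subset n) m →
    partialCost R F G S m ≡ Σ< m (λ i → F (S (suc i)) * (G (S (suc i)) - G (S i)))
  partialCost≡Σ< F G S zero    = ≡.refl
  partialCost≡Σ< F G S (suc m) = ≡.cong (_+ _) (partialCost≡Σ< F G S m)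

  module _ {n} (f g : Subset n → Carrier) where

    reversedCost : (ℕ → Subset n) → ℕ → Carrier
    reversedCost S m = Σ< m (λ i → (g ⊤ - g (S i)) * (f (S (suc i)) - f (S i)))

    partialCost≈reversedCost : ∀ (S : ℕ → Subset n) m → f (S 0) ≈ 0# → g (S m) ≈ g ⊤ →
      partialCost R f g S m ≈ reversedCost S m
    partialCost≈reversedCost S m a₀≈0 bₘ≈B = begin
      partialCost R f g S m
        ≡⟨ partialCost≡Σ< f g S m ⟩
      Σ< m (λ i → f (S (suc i)) * (g (S (suc i)) - g (S i)))
        ≈⟨ summation-by-parts-without-boundary (f ∘ S) (g ∘ S) (g ⊤) m a₀≈0 bₘ≈B ⟩
      reversedCost S m ∎

    dualPartialCost≈reversedCost : ∀ (S T : ℕ → Subset n) m →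
      (∀ j → j ℕ.≤ m → ∁ (T j) ≡ S (m ∸ j)) →
      partialCost R (dualFun R g) (dualFun R f) T m ≈ reversedCost S m
    dualPartialCost≈reversedCost S T m ∁T≡S = begin
      partialCost R (dualFun R g) (dualFun R f) T m ≡⟨ partialCost≡Σ< _ _ T m ⟩
      Σ< m dualTerm                                 ≈⟨ Σ<-cong m dualTerm≈ ⟩
      Σ< m (λ j → term (m ∸ suc j))                 ≈⟨ Σ<-reverse m term ⟩
      reversedCost S m                              ∎
      where
      term dualTerm : ℕ → Carrier
      term i = (g ⊤ - g (S i)) * (f (S (suc i)) - f (S i))
      dualTerm j = (g ⊤ - g (∁ (T (suc j)))) * ((f ⊤ - f (∁ (T (suc j)))) - (f ⊤ - f (∁ (T j))))

      dualTerm≈ : ∀ j → j ℕ.< m → dualTerm j ≈ term (m ∸ suc j)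
      dualTerm≈ j j<m = begin
        dualTerm j
          ≡⟨ ≡.cong₂ (λ X Y → (g ⊤ - g X) * ((f ⊤ - f X) - (f ⊤ - f Y)))
                   (∁T≡S (suc j) j<m)
                   (≡.trans (∁T≡S j (<⇒≤ j<m)) (≡.cong S (+-∸-assoc 1 j<m))) ⟩
        (g ⊤ - g (S i)) * ((f ⊤ - f (S i)) - (f ⊤ - f (S (suc i))))
          ≈⟨ *-congˡ ([x-z]-[x-y]≈y-z (f ⊤) (f (S (suc i))) (f (S i))) ⟩
        term i ∎
        where i = m ∸ suc j

    cost≈dualPartialCost : ∀ {𝓖 : Subset n → Set} (𝓢 : Chain 𝓖) (T : ℕ → Subset n) →
      f ⊥ ≈ 0# → (∀ j → j ℕ.≤ k 𝓢 → ∁ (T j) ≡ S 𝓢 (k 𝓢 ∸ j)) →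
      cost R f g 𝓢 ≈ partialCost R (dualFun R g) (dualFun R f) T (k 𝓢)
    cost≈dualPartialCost 𝓢 T f⊥≈0 ∁T≡S = begin
      cost R f g 𝓢
        ≈⟨ partialCost≈reversedCost (S 𝓢) (k 𝓢) f₀≈0 gₖ≈g⊤ ⟩
      reversedCost (S 𝓢) (k 𝓢)
        ≈⟨ sym (dualPartialCost≈reversedCost (S 𝓢) T (k 𝓢) ∁T≡S) ⟩
      partialCost R (dualFun R g) (dualFun R f) T (k 𝓢) ∎
      where
      f₀≈0 = trans (reflexive (≡.cong f (S₀≡∅ 𝓢))) f⊥≈0
      gₖ≈g⊤ = reflexive (≡.cong g (Sₖ≡V 𝓢))

module ApproximationTransfer {c ℓ₁ ℓ₂} (R : OrderedCommRing c ℓ₁ ℓ₂) where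
  open OrderedCommRing R
  open PreorderReasoning (IsTotalOrder.isPreorder isTotalOrder)

  IsApprox-⇔ : ∀ {n} {𝓖 𝓗 : Subset n → Set} {F G F′ G′ : Subset n → Carrier}
    (φ : Chain 𝓖 → Chain 𝓗) (ψ : Chain 𝓗 → Chain 𝓖) →
    (∀ 𝓢 → cost R F G 𝓢 ≈ cost R F′ G′ (φ 𝓢)) →
    (∀ 𝓣 → cost R F G (ψ 𝓣) ≈ cost R F′ G′ 𝓣) →
    ∀ α 𝓢 → IsApprox R F G 𝓖 α 𝓢 ⇔ IsApprox R F′ G′ 𝓗 α (φ 𝓢)
  IsApprox-⇔ {F = F} {G} {F′} {G′} φ ψ φ-cost ψ-cost α 𝓢 = mk⇔ to from
    where
    to : IsApprox R F G _ α 𝓢 → IsApprox R F′ G′ _ α (φ 𝓢)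
    to approx 𝓣 = begin
      cost R F′ G′ (φ 𝓢)     ≈⟨ sym (φ-cost 𝓢) ⟩
      cost R F G 𝓢           ≲⟨ approx (ψ 𝓣) ⟩
      α * cost R F G (ψ 𝓣)   ≈⟨ *-congˡ (ψ-cost 𝓣) ⟩
      α * cost R F′ G′ 𝓣     ∎
    from : IsApprox R F′ G′ _ α (φ 𝓢) → IsApprox R F G _ α 𝓢
    from approx 𝓣 = begin
      cost R F G 𝓢           ≈⟨ φ-cost 𝓢 ⟩
      cost R F′ G′ (φ 𝓢)     ≲⟨ approx (φ 𝓣) ⟩
      α * cost R F′ G′ (φ 𝓣) ≈⟨ *-congˡ (sym (φ-cost 𝓣)) ⟩
      α * cost R F G 𝓣       ∎

lemma5 : ∀ {c ℓ₁ ℓ₂} (R : OrderedCommRing c ℓ₁ ℓ₂) →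
  let open OrderedCommRing R in
  (n : ℕ) (𝓕 : Subset n → Set) → 𝓕 ⊥ → 𝓕 ⊤ →
  (f g : Subset n → Carrier) →
  Monotone R 𝓕 f → Monotone R 𝓕 g →
  f ⊥ ≈ 0# → g ⊥ ≈ 0# →
  (𝓢 : Chain 𝓕) →
  (cost R f g 𝓢 ≈ cost R (dualFun R g) (dualFun R f) (dual 𝓢))
  × (∀ α → 1# ≤ α →
      (IsApprox R f g 𝓕 α 𝓢
        ⇔ IsApprox R (dualFun R g) (dualFun R f) (𝓕 #) α (dual 𝓢)))
lemma5 R n 𝓕 _ _ f g _ _ f⊥≈0 _ 𝓢 =
  cost-dual 𝓢 , λ α _ → IsApprox-⇔ dual (undual {𝓕 = 𝓕}) cost-dual cost-undual α 𝓢
  where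
  open OrderedCommRing R
  open Duality R
  open ApproximationTransfer R

  cost-dual : (𝓢 : Chain 𝓕) → cost R f g 𝓢 ≈ cost R (dualFun R g) (dualFun R f) (dual 𝓢)
  cost-dual 𝓢 = cost≈dualPartialCost f g 𝓢 _ f⊥≈0 (λ j _ → ∁-involutive _)

  cost-undual : (𝓣 : Chain (𝓕 #)) →
    cost R f g (undual {𝓕 = 𝓕} 𝓣) ≈ cost R (dualFun R g) (dualFun R f) 𝓣
  cost-undual 𝓣 = cost≈dualPartialCost f g (undual {𝓕 = 𝓕} 𝓣) (S 𝓣) f⊥≈0
    (λ j j≤k → ≡.cong (∁ ∘ S 𝓣) (≡.sym (m∸[m∸n]≡n j≤k)))
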